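{- If a graph is $p$-arrangeable, then it is $(p,2^{p-1})$-degenerate.
   Context: A graph is $p$-arrangeable if there is an ordering $v_1,\ldots,v_n$ of its vertices such that for every $v_i$, the neighbors of $v_i$ among $\{v_j: j>i\}$ have together at most $p$ neighbors among $\{v_1,\ldots,v_i\}$ (including $v_i$). A graph $H$ is $(d,\Delta)$-degenerate if there is an ordering $v_1,\ldots,v_n$ of its vertices such that for each $v_i$: (1) at most $d$ vertices $v_j$ with $j<i$ are adjacent to $v_i$, and (2) there are at most $\Delta$ subsets $S\subset\{v_1,\ldots,v_i\}$ such that $S=N(v_j)\cap\{v_1,\ldots,v_i\}$ for some neighbor $v_j$ of $v_i$ with $j>i$, where $N(v)$ is the set of neighbors of $v$. -}

module Defs where

open import Data.Nat using (ℕ; _≤_)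
open import Data.Fin using (Fin; _<?_; _≤?_)
open import Data.Fin.Subset using (Subset)
open import Data.Bool using (Bool; true; false; _∧_)
open import Data.List using (List; length; filterᵇ; allFin; map; deduplicate)
open import Data.Bool.ListAction using (any)
open import Data.Vec using (tabulate)
open import Data.Vec.Properties using (≡-dec)
open import Data.Bool.Properties using () renaming (_≟_ to _≟ᵇ_)
open import Relation.Nullary.Decidable using (⌊_⌋)
open import Relation.Binary.PropositionalEquality using (_≡_)
open import Function.Definitions using (Injective)
open import Data.Product using (Σ; _×_)

record Graph (n : ℕ) : Set where
  field
    adj   : Fin n → Fin n → Bool
    sym   : ∀ u v → adj u v ≡ adj v u
    irrefl : ∀ v → adj v v ≡ false
open Graph public

-- An ordering v_1,…,v_n of the vertices, given by the (injective, hence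
-- bijective) position map π : vertex ↦ its index in the ordering.
Ordering : ℕ → Set
Ordering n = Σ (Fin n → Fin n) (Injective _≡_ _≡_)

module _ {n : ℕ} (G : Graph n) (o : Ordering n) where
  private
    π = Data.Product.proj₁ o
  open import Data.Product using (proj₁)

  before : Fin n → Fin n → Bool
  before u w = ⌊ π u <? π w ⌋

  atMost : Fin n → Fin n → Bool
  atMost u w = ⌊ π u ≤? π w ⌋

  laterNbrs : Fin n → List (Fin n)
  laterNbrs v = filterᵇ (λ w → before v w ∧ adj G v w) (allFin n)

  arrSet : Fin n → List (Fin n)
  arrSet v = filterᵇ (λ u → atMost u v ∧ any (adj G u) (laterNbrs v)) (allFin n)

  earlierNbrs : Fin n → List (Fin n)
  earlierNbrs v = filterᵇ (λ u → before u v ∧ adj G u v) (allFin n)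

  trace : Fin n → Fin n → Subset n
  trace v w = tabulate (λ u → adj G u w ∧ atMost u v)

  traces : Fin n → List (Subset n)
  traces v = deduplicate (≡-dec _≟ᵇ_) (map (trace v) (laterNbrs v))

  IsPArrangement : ℕ → Set
  IsPArrangement p = ∀ v → length (arrSet v) ≤ p

  IsDegenerateOrdering : ℕ → ℕ → Set
  IsDegenerateOrdering d Δ = ∀ v → length (earlierNbrs v) ≤ d × length (traces v) ≤ Δ

Arrangeable : ∀ {n} → Graph n → ℕ → Set
Arrangeable G p = Σ (Ordering _) λ o → IsPArrangement G o p

Degenerate : ∀ {n} → Graph n → ℕ → ℕ → Set
Degenerate G d Δ = Σ (Ordering _) λ o → IsDegenerateOrdering G o d Δ

module Submission where

-- If w is the latest earlier neighbour of v, then v is a later neighbour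
-- of w, so all earlier neighbours of v lie in the arrangement set of w: there are at most p.
-- For a later neighbour w of v, the trace N(w) ∩ {v_1,…,v_i} contains v and lies inside the
-- arrangement set A of v; distinct sets between {v} and A number at most 2^(|A| - 1) ≤ 2^(p - 1).

open import Defs hiding (sym)
open import Data.Nat using (ℕ; zero; suc; _+_; _^_; _∸_; _≤_; _<_; pred; z≤n; s≤s)
open import Data.Nat.Properties
  using (+-mono-≤; +-identityʳ; +-suc; ≤-trans; ≤-reflexive; ^-monoʳ-≤; suc[m]≤n⇒m≤pred[n]; pred[m∸n]≡m∸[1+n]; module ≤-Reasoning)
open import Data.Fin using (Fin) renaming (zero to fzero; suc to fsuc; _≤_ to _≤ᶠ_)
import Data.Fin.Properties as Fin
open import Data.Fin.Subset using (Subset; inside; outside; ⁅_⁆; _─_; _-_; ∣_∣; _⊆_) renaming (_∈_ to _∈ₛ_)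
open import Data.Fin.Subset.Properties using (drop-∷-⊆; x∈⁅x⁆; x∈⁅y⁆⇒x≡y; x∈p⇒∣p-x∣<∣p∣)
open import Data.Bool using (Bool; true; false; T; _∧_)
open import Data.Bool.Properties using (T-∧; T-≡) renaming (_≟_ to _≟ᵇ_)
open import Data.Bool.ListAction using (any)
open import Data.List using (List; []; _∷_; length; filterᵇ; allFin)
import Data.List as List
open import Data.List.Relation.Unary.All as All using (All; []; _∷_)
import Data.List.Relation.Unary.All.Properties as All
open import Data.List.Relation.Unary.Any using (here; there)
open import Data.List.Relation.Unary.Any.Properties using (any⁺)
open import Data.List.Relation.Unary.AllPairs using ([]; _∷_)
open import Data.List.Relation.Unary.Unique.Propositional using (Unique)
open import Data.List.Relation.Unary.Unique.DecPropositional.Properties using (deduplicate-!)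
open import Data.List.Membership.Propositional using (_∈_; lose)
open import Data.List.Membership.Propositional.Properties
  using (∈-filter⁺; ∈-filter⁻; ∈-allFin; ∈-map⁻; ∈-deduplicate⁻)
open import Data.List.Relation.Binary.Sublist.Propositional using (⊆-refl)
open import Data.List.Relation.Binary.Sublist.Propositional.Properties using (filter⁺; length-mono-≤)
import Data.List.Extrema as Extrema
open import Data.Vec as Vec using ([]; _∷_; head)
open import Data.Vec.Properties using (≡-dec; lookup∘tabulate; []=⇒lookup; lookup⇒[]=)
open import Data.Product using (_×_; _,_; proj₁; proj₂)
open import Function using (id; _∘_; _⇔_; mk⇔; Equivalence)
open import Relation.Nullary using (does; yes; no; contradiction)
open import Relation.Nullary.Decidable using (T?; fromWitness)
open import Relation.Binary.PropositionalEquality using (_≡_; refl; sym; trans; cong; subst)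

open Equivalence using (to; from)

private variable
  n : ℕ
  A : Set

length-≤-from-∈ : ∀ {m} (xs : List A) → (∀ {x} → x ∈ xs → length xs ≤ m) → length xs ≤ m
length-≤-from-∈ []       _ = z≤n
length-≤-from-∈ (x ∷ xs) h = h (here refl)

∈-filterᵇ-allFin : ∀ {n} {f : Fin n → Bool} {x} → x ∈ filterᵇ f (allFin n) ⇔ T (f x)
∈-filterᵇ-allFin {n} {f} = mk⇔ (proj₂ ∘ ∈-filter⁻ (T? ∘ f) {xs = allFin n}) (∈-filter⁺ (T? ∘ f) (∈-allFin _))

length-filterᵇ-allFin-mono : ∀ {f g : Fin n → Bool} →
  (∀ {x} → x ∈ filterᵇ f (allFin n) → x ∈ filterᵇ g (allFin n)) →
  length (filterᵇ f (allFin n)) ≤ length (filterᵇ g (allFin n))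
length-filterᵇ-allFin-mono {n} {f} {g} f⊆g = length-mono-≤
  (filter⁺ (T? ∘ f) (T? ∘ g) (λ { refl → to ∈-filterᵇ-allFin ∘ f⊆g ∘ from ∈-filterᵇ-allFin }) (⊆-refl {x = allFin n}))

∈-tabulate : ∀ {f : Fin n → Bool} {x} → x ∈ₛ Vec.tabulate f ⇔ T (f x)
∈-tabulate {f = f} {x} = mk⇔
  (λ x∈ → from T-≡ (trans (sym (lookup∘tabulate f x)) ([]=⇒lookup x∈)))
  (λ fx → lookup⇒[]= x _ (trans (lookup∘tabulate f x) (to T-≡ fx)))

length-filterᵇ-tabulate : ∀ (f : A → Bool) (g : Fin n → A) →
                          length (filterᵇ f (List.tabulate g)) ≡ ∣ Vec.tabulate (f ∘ g) ∣
length-filterᵇ-tabulate {n = zero}  f g = refl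
length-filterᵇ-tabulate {n = suc n} f g with f (g fzero)
... | true  = cong suc (length-filterᵇ-tabulate f (g ∘ fsuc))
... | false = length-filterᵇ-tabulate f (g ∘ fsuc)

Between : Subset n → Subset n → Subset n → Set
Between q p t = q ⊆ t × t ⊆ p

tailsWithHead : Bool → List (Subset (suc n)) → List (Subset n)
tailsWithHead b []             = []
tailsWithHead b ((c ∷ t) ∷ ts) with does (c ≟ᵇ b)
... | true  = t ∷ tailsWithHead b ts
... | false = tailsWithHead b ts

length-tailsWithHead-split : ∀ (ts : List (Subset (suc n))) →
  length ts ≡ length (tailsWithHead true ts) + length (tailsWithHead false ts)
length-tailsWithHead-split []                  = refl
length-tailsWithHead-split ((true  ∷ t) ∷ ts) = cong suc (length-tailsWithHead-split ts)
length-tailsWithHead-split ((false ∷ t) ∷ ts) =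
  trans (cong suc (length-tailsWithHead-split ts)) (sym (+-suc _ _))

length-tailsWithHead-all : ∀ b (ts : List (Subset (suc n))) →
  All (λ t → head t ≡ b) ts → length (tailsWithHead b ts) ≡ length ts
length-tailsWithHead-all b     []             []          = refl
length-tailsWithHead-all true  ((_ ∷ t) ∷ ts) (refl ∷ hs) = cong suc (length-tailsWithHead-all true ts hs)
length-tailsWithHead-all false ((_ ∷ t) ∷ ts) (refl ∷ hs) = cong suc (length-tailsWithHead-all false ts hs)

∈-tailsWithHead⁻ : ∀ b (ts : List (Subset (suc n))) {t} → t ∈ tailsWithHead b ts → (b ∷ t) ∈ ts
∈-tailsWithHead⁻ b ((c ∷ t) ∷ ts) t∈ with c ≟ᵇ b | t∈
... | yes refl | here refl = here refl
... | yes refl | there t∈′ = there (∈-tailsWithHead⁻ b ts t∈′)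
... | no  _    | t∈′       = there (∈-tailsWithHead⁻ b ts t∈′)

tailsWithHead-unique : ∀ b (ts : List (Subset (suc n))) → Unique ts → Unique (tailsWithHead b ts)
tailsWithHead-unique b []             []         = []
tailsWithHead-unique b ((c ∷ t) ∷ ts) (t∉ ∷ uts) with c ≟ᵇ b
... | yes refl = All.tabulate (λ t′∈ t≡t′ → All.lookup t∉ (∈-tailsWithHead⁻ b ts t′∈) (cong (b ∷_) t≡t′))
                 ∷ tailsWithHead-unique b ts uts
... | no  _    = tailsWithHead-unique b ts uts

tailsWithHead-between : ∀ b {q p : Subset n} {c a} (ts : List (Subset (suc n))) →
  All (Between (c ∷ q) (a ∷ p)) ts → All (Between q p) (tailsWithHead b ts)
tailsWithHead-between b ts bts = All.tabulate λ t∈ →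
  let q⊆t , t⊆p = All.lookup bts (∈-tailsWithHead⁻ b ts t∈) in drop-∷-⊆ q⊆t , drop-∷-⊆ t⊆p

head-between-inside : ∀ {q : Subset n} {p t} → Between (inside ∷ q) p t → head t ≡ inside
head-between-inside {t = _ ∷ _} (q⊆t , _) = []=⇒lookup (q⊆t Vec.here)

head-between-outside : ∀ {p : Subset n} {q t} → Between q (outside ∷ p) t → head t ≡ outside
head-between-outside {t = outside ∷ _} _         = refl
head-between-outside {t = inside  ∷ _} (_ , t⊆p) with t⊆p Vec.here
... | ()

length-between-∷ : ∀ {q p : Subset n} c a (ts : List (Subset (suc n))) →
  (∀ b → length (tailsWithHead b ts) ≤ 2 ^ ∣ p ─ q ∣) → All (Between (c ∷ q) (a ∷ p)) ts →
  length ts ≤ 2 ^ ∣ (a ∷ p) ─ (c ∷ q) ∣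
length-between-∷ {q = q} {p} outside inside ts bound _ = begin
  length ts                                                     ≡⟨ length-tailsWithHead-split ts ⟩
  length (tailsWithHead true ts) + length (tailsWithHead false ts) ≤⟨ +-mono-≤ (bound true) (bound false) ⟩
  2 ^ ∣ p ─ q ∣ + 2 ^ ∣ p ─ q ∣                                 ≡⟨ cong (2 ^ ∣ p ─ q ∣ +_) (sym (+-identityʳ _)) ⟩
  2 ^ suc ∣ p ─ q ∣                                             ∎
  where open ≤-Reasoning
length-between-∷ inside inside ts bound bts =
  ≤-trans (≤-reflexive (sym (length-tailsWithHead-all inside ts (All.map head-between-inside bts)))) (bound inside)
length-between-∷ outside outside ts bound bts =
  ≤-trans (≤-reflexive (sym (length-tailsWithHead-all outside ts (All.map head-between-outside bts)))) (bound outside)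
length-between-∷ inside outside []      _ _          = z≤n
length-between-∷ inside outside (_ ∷ _) _ (bt ∷ _) =
  contradiction (trans (sym (head-between-inside bt)) (head-between-outside bt)) λ ()

length-between : ∀ (q p : Subset n) (ts : List (Subset n)) → Unique ts → All (Between q p) ts →
                 length ts ≤ 2 ^ ∣ p ─ q ∣
length-between []      []      []            _                _   = z≤n
length-between []      []      (_ ∷ [])      _                _   = s≤s z≤n
length-between []      []      ([] ∷ [] ∷ _) ((t≢t′ ∷ _) ∷ _) _   = contradiction refl t≢t′
length-between (c ∷ q) (a ∷ p) ts            uts              bts =
  length-between-∷ c a ts
    (λ b → length-between q p (tailsWithHead b ts) (tailsWithHead-unique b ts uts) (tailsWithHead-between b ts bts))
    bts

module _ {n} (G : Graph n) (o : Ordering n) where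
  private
    π : Fin n → Fin n
    π = proj₁ o
  open Extrema (Fin.≤-totalOrder n) using (argmax; argmax-all; f[xs]≤f[argmax])

  ∈-earlierNbrs⇒∈-laterNbrs : ∀ {u v} → u ∈ earlierNbrs G o v → v ∈ laterNbrs G o u
  ∈-earlierNbrs⇒∈-laterNbrs = from ∈-filterᵇ-allFin ∘ to ∈-filterᵇ-allFin

  adj-of-∈-laterNbrs : ∀ {v w} → w ∈ laterNbrs G o v → T (adj G v w)
  adj-of-∈-laterNbrs {v} {w} w∈ = proj₂ (to (T-∧ {before G o v w}) (to ∈-filterᵇ-allFin w∈))

  earlierNbrs⊆arrSet : ∀ {v w} → v ∈ laterNbrs G o w → (∀ {u} → u ∈ earlierNbrs G o v → π u ≤ᶠ π w) →
                       ∀ {u} → u ∈ earlierNbrs G o v → u ∈ arrSet G o w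
  earlierNbrs⊆arrSet v∈ latest {u} u∈ =
    from ∈-filterᵇ-allFin (from T-∧ (fromWitness (latest u∈) , any⁺ (adj G u) (lose v∈ adj-u-v)))
    where adj-u-v = proj₂ (to T-∧ (to ∈-filterᵇ-allFin u∈))

  arrSubset : Fin n → Subset n
  arrSubset v = Vec.tabulate λ u → atMost G o u v ∧ any (adj G u) (laterNbrs G o v)

  length-arrSet : ∀ v → length (arrSet G o v) ≡ ∣ arrSubset v ∣
  length-arrSet v = length-filterᵇ-tabulate (λ u → atMost G o u v ∧ any (adj G u) (laterNbrs G o v)) id

  trace-between : ∀ {v w} → w ∈ laterNbrs G o v → Between ⁅ v ⁆ (arrSubset v) (trace G o v w)
  trace-between {v} {w} w∈ = ⁅v⁆⊆trace , trace⊆arrSubset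
    where
    v∈trace : v ∈ₛ trace G o v w
    v∈trace = from ∈-tabulate (from T-∧ (adj-of-∈-laterNbrs w∈ , fromWitness Fin.≤-refl))
    ⁅v⁆⊆trace : ⁅ v ⁆ ⊆ trace G o v w
    ⁅v⁆⊆trace u∈ = subst (_∈ₛ trace G o v w) (sym (x∈⁅y⁆⇒x≡y v u∈)) v∈trace
    trace⊆arrSubset : trace G o v w ⊆ arrSubset v
    trace⊆arrSubset {u} u∈ =
      let adj-u-w , u≤v = to T-∧ (to (∈-tabulate {f = λ u → adj G u w ∧ atMost G o u v}) u∈)
      in from ∈-tabulate (from T-∧ (u≤v , any⁺ (adj G u) (lose w∈ adj-u-w)))

  module _ {p} (arrangement : IsPArrangement G o p) where

    length-earlierNbrs : ∀ v → length (earlierNbrs G o v) ≤ p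
    length-earlierNbrs v = length-≤-from-∈ (earlierNbrs G o v) λ {e} e∈ →
      let w = argmax π e (earlierNbrs G o v)
          w∈ = argmax-all π e∈ (All.tabulate id)
          latest = All.lookup (f[xs]≤f[argmax] {f = π} e (earlierNbrs G o v))
      in ≤-trans (length-filterᵇ-allFin-mono (earlierNbrs⊆arrSet (∈-earlierNbrs⇒∈-laterNbrs w∈) latest)) (arrangement w)

    ∣arrSubset-v∣≤p∸1 : ∀ {v} → v ∈ₛ arrSubset v → ∣ arrSubset v - v ∣ ≤ p ∸ 1
    ∣arrSubset-v∣≤p∸1 {v} v∈ = begin
      ∣ arrSubset v - v ∣ ≤⟨ suc[m]≤n⇒m≤pred[n] ∣arrSubset-v∣<p ⟩
      pred p              ≡⟨ pred[m∸n]≡m∸[1+n] p 0 ⟩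
      p ∸ 1               ∎
      where
      open ≤-Reasoning
      ∣arrSubset-v∣<p : ∣ arrSubset v - v ∣ < p
      ∣arrSubset-v∣<p = begin-strict
        ∣ arrSubset v - v ∣    <⟨ x∈p⇒∣p-x∣<∣p∣ v∈ ⟩
        ∣ arrSubset v ∣        ≡⟨ sym (length-arrSet v) ⟩
        length (arrSet G o v) ≤⟨ arrangement v ⟩
        p                     ∎

    length-traces : ∀ v → length (traces G o v) ≤ 2 ^ (p ∸ 1)
    length-traces v = length-≤-from-∈ (traces G o v) λ t∈ →
      let _ , w∈ , _ = ∈-map⁻ (trace G o v) (∈-deduplicate⁻ (≡-dec _≟ᵇ_) _ t∈)
          ⁅v⁆⊆t , t⊆arrSubset = trace-between w∈
      in ≤-trans (length-between ⁅ v ⁆ (arrSubset v) (traces G o v) (deduplicate-! (≡-dec _≟ᵇ_) _) traces-between)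
                 (^-monoʳ-≤ 2 (∣arrSubset-v∣≤p∸1 (t⊆arrSubset (⁅v⁆⊆t (x∈⁅x⁆ v)))))
      where
      traces-between : All (Between ⁅ v ⁆ (arrSubset v)) (traces G o v)
      traces-between = All.deduplicate⁺ (≡-dec _≟ᵇ_) (All.map⁺ (All.tabulate trace-between))

lemma4p2 : ∀ {n : ℕ} (G : Graph n) (p : ℕ) → Arrangeable G p → Degenerate G p (2 ^ (p ∸ 1))
lemma4p2 G p (o , arrangement) = o , λ v → length-earlierNbrs G o arrangement v , length-traces G o arrangement v
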